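{- Let $(\mathbb{A},D)$ be a designated $\mathsf{Cobounded}$-algebra whose underlying set contains more than two elements. Then $\mathsf{Extensionality}$, i.e. $\forall x\forall y\big(\forall z(z\in x\leftrightarrow z\in y)\to x=y\big)$, is not valid in $\mathbf{V}^{(\mathbb{A})}$ under $\llbracket\cdot\rrbracket_{\mathrm{PA}}$ with designated set $D$.
   Context: A designated set is a lattice filter $D$ with $\mathbf{1}\in D$, $\mathbf{0}\notin D$. A $\mathsf{Cobounded}$-algebra is $\langle\mathbf{A},\wedge,\vee,\Rightarrow,\mathbf{1},\mathbf{0}\rangle$ with complete distributive lattice reduct, such that $\bigvee_i a_i=\mathbf{1}$ implies some $a_j=\mathbf{1}$, $\bigwedge_i a_i=\mathbf{0}$ implies some $a_j=\mathbf{0}$, and $a\Rightarrow b=\mathbf{0}$ if $a\ne\mathbf{0},b=\mathbf{0}$, else $\mathbf{1}$. A designated $\mathsf{Cobounded}$-algebra $(\mathbb{A},D)$ adds ${}^*$: $a^*=\mathbf{0}$ if $a=\mathbf{1}$, $a^*=a$ if $a\in D\setminus\{\mathbf{1}\}$, $a^*=\mathbf{1}$ if $a\notin D$. $\mathbf{V}^{(\mathbb{A})}$ = class of $\mathbf{A}$-valued functions defined by recursion ($\mathbf{V}^{(\mathbb{A})}_\alpha$ = functions with range in $\mathbf{A}$ and domain $\subseteq\mathbf{V}^{(\mathbb{A})}_\xi$, $\xi<\alpha$). $\llbracket u\in v\rrbracket_{\mathrm{PA}}=\bigvee_{x\in\mathrm{dom}(v)}(v(x)\wedge\llbracket x=u\rrbracket_{\mathrm{PA}})$,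 $\llbracket u=v\rrbracket_{\mathrm{PA}}=\bigwedge_{x\in\mathrm{dom}(u)}((u(x)\Rightarrow\llbracket x\in v\rrbracket_{\mathrm{PA}})\wedge(\llbracket x\in v\rrbracket_{\mathrm{PA}}^*\Rightarrow u(x)^*))\wedge\bigwedge_{y\in\mathrm{dom}(v)}((v(y)\Rightarrow\llbracket y\in u\rrbracket_{\mathrm{PA}})\wedge(\llbracket y\in u\rrbracket_{\mathrm{PA}}^*\Rightarrow v(y)^*))$, extended homomorphically (connectives to $\wedge,\vee,\Rightarrow,{}^*$, quantifiers to $\bigwedge,\bigvee$ over $\mathbf{V}^{(\mathbb{A})}$; $\varphi\leftrightarrow\psi$ abbreviates $(\varphi\to\psi)\wedge(\psi\to\varphi)$). Valid means value in $D$. -}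

module Defs where

open import Level using (Lift; lift)
open import Data.Product using (Σ; _×_; _,_)
open import Relation.Nullary using (¬_)
open import Relation.Binary.PropositionalEquality using (_≡_; _≢_)
open import Algebra.Lattice.Structures using (IsDistributiveLattice)

-- A Cobounded-algebra: complete distributive lattice (carrier a set,
-- arbitrary meets/joins indexed by types up to Set₁, so that quantifiers
-- over the class V^(A) : Set₁ can be interpreted), top 𝟏, bottom 𝟎, the
-- co-boundedness conditions, and ⇒ given by its defining cases.
record CoboundedAlgebra : Set₂ where
  infixr 7 _∧_
  infixr 6 _∨_
  infixr 5 _⇒_
  field
    Carrier : Set
    _∧_ _∨_ _⇒_ : Carrier → Carrier → Carrier
    𝟏 𝟎 : Carrier
    ⋀ ⋁ : {I : Set₁} → (I → Carrier) → Carrier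
    isDistributiveLattice : IsDistributiveLattice _≡_ _∨_ _∧_

  _≤_ : Carrier → Carrier → Set
  a ≤ b = a ∧ b ≡ a

  field
    𝟏-top    : ∀ a → a ≤ 𝟏
    𝟎-bottom : ∀ a → 𝟎 ≤ a
    ⋀-lower    : ∀ {I : Set₁} (f : I → Carrier) (i : I) → ⋀ f ≤ f i
    ⋀-greatest : ∀ {I : Set₁} (f : I → Carrier) (a : Carrier) → (∀ i → a ≤ f i) → a ≤ ⋀ f
    ⋁-upper    : ∀ {I : Set₁} (f : I → Carrier) (i : I) → f i ≤ ⋁ f
    ⋁-least    : ∀ {I : Set₁} (f : I → Carrier) (a : Carrier) → (∀ i → f i ≤ a) → ⋁ f ≤ a
    ⋁-cobounded : ∀ {I : Set₁} (f : I → Carrier) → ⋁ f ≡ 𝟏 → Σ I (λ j → f j ≡ 𝟏)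
    ⋀-cobounded : ∀ {I : Set₁} (f : I → Carrier) → ⋀ f ≡ 𝟎 → Σ I (λ j → f j ≡ 𝟎)
    ⇒-zero : ∀ a b → a ≢ 𝟎 → b ≡ 𝟎 → a ⇒ b ≡ 𝟎
    ⇒-one  : ∀ a b → ¬ (a ≢ 𝟎 × b ≡ 𝟎) → a ⇒ b ≡ 𝟏

record DesignatedCoboundedAlgebra : Set₂ where
  field
    𝔸 : CoboundedAlgebra
  open CoboundedAlgebra 𝔸
  field
    D : Carrier → Set
    D-upward : ∀ {a b} → D a → a ≤ b → D b
    D-∧      : ∀ {a b} → D a → D b → D (a ∧ b)
    D-𝟏      : D 𝟏
    D-𝟎      : ¬ D 𝟎
    _* : Carrier → Carrier
    *-𝟏   : ∀ a → a ≡ 𝟏 → a * ≡ 𝟎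
    *-D   : ∀ a → D a → a ≢ 𝟏 → a * ≡ a
    *-¬D  : ∀ a → ¬ D a → a * ≡ 𝟏

-- The universe V^(A): a name is a Set-indexed family of names, each
-- labelled with a truth value (domain element x_i ↦ value u(x_i)).
data V (A : Set) : Set₁ where
  mk : (I : Set) → (I → V A) → (I → A) → V A

module Semantics (𝔻 : DesignatedCoboundedAlgebra) where
  open DesignatedCoboundedAlgebra 𝔻
  open CoboundedAlgebra 𝔸

  ⋀₀ ⋁₀ : {I : Set} → (I → Carrier) → Carrier
  ⋀₀ {I} f = ⋀ {Lift _ I} (λ { (lift i) → f i })
  ⋁₀ {I} f = ⋁ {Lift _ I} (λ { (lift i) → f i })

  mutual
    ⟦_∈_⟧ : V Carrier → V Carrier → Carrier
    ⟦ u ∈ mk J y b ⟧ = ⋁₀ (λ j → b j ∧ ⟦ y j ≐ u ⟧)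

    ⟦_≐_⟧ : V Carrier → V Carrier → Carrier
    ⟦ mk I x a ≐ mk J y b ⟧ =
      ⋀₀ (λ i → (a i ⇒ ⟦ x i ∈ mk J y b ⟧) ∧ ((⟦ x i ∈ mk J y b ⟧ *) ⇒ (a i *)))
      ∧ ⋀₀ (λ j → (b j ⇒ ⟦ y j ∈ mk I x a ⟧) ∧ ((⟦ y j ∈ mk I x a ⟧ *) ⇒ (b j *)))

  _⇔_ : Carrier → Carrier → Carrier
  p ⇔ q = (p ⇒ q) ∧ (q ⇒ p)

  ⟦Extensionality⟧ : Carrier
  ⟦Extensionality⟧ =
    ⋀ (λ (x : V Carrier) → ⋀ (λ (y : V Carrier) →
      ⋀ (λ (z : V Carrier) → ⟦ z ∈ x ⟧ ⇔ ⟦ z ∈ y ⟧) ⇒ ⟦ x ≐ y ⟧))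

  Valid : Carrier → Set
  Valid p = D p

MoreThanTwoElements : Set → Set
MoreThanTwoElements A =
  Σ A (λ a → Σ A (λ b → Σ A (λ c → a ≢ b × a ≢ c × b ≢ c)))

{-# OPTIONS --safe #-}
-- Every equality value ⟦ u ≐ v ⟧ is a meet of implications, and implications
-- only take the values 𝟎 and 𝟏. Hence ⟦ z ∈ singleton ∅ c ⟧ = c ∧ ⟦ ∅ ≐ z ⟧ and
-- ⟦ z ∈ singleton ∅ 𝟏 ⟧ = 𝟏 ∧ ⟦ ∅ ≐ z ⟧ vanish for exactly the same z when c ≠ 𝟎,
-- so the two names have the same members with value 𝟏. If moreover c ≠ 𝟏, then
-- c * ≠ 𝟎 = 𝟏 *, so the clause ⟦ ∅ ∈ singleton ∅ c ⟧ * ⇒ 𝟏 * of their equality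
-- is 𝟎. Extensionality at these two names thus has value 𝟏 ⇒ 𝟎 = 𝟎 ∉ D, and an
-- element c ∉ {𝟎, 𝟏} cannot fail to exist in an algebra with three elements.
module Submission where

open import Defs
open import Level using (lift)
open import Data.Empty using (⊥)
open import Data.Unit using (⊤; tt)
open import Data.Product using (Σ; _×_; _,_)
open import Relation.Nullary using (¬_)
open import Function using (_∘_)
open import Relation.Binary.PropositionalEquality
open import Algebra.Lattice.Bundles using (Lattice)
open import Algebra.Lattice.Structures using (IsDistributiveLattice)
import Algebra.Lattice.Properties.Lattice as LatticeProperties

moreThanTwoElements⇒¬¬∉pair : {A : Set} → MoreThanTwoElements A →
  (p q : A) → ¬ ¬ Σ A (λ x → x ≢ p × x ≢ q)
moreThanTwoElements⇒¬¬∉pair (a , b , c , a≢b , a≢c , b≢c) p q nothingOutside =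
  inPair a (onlyOneIn inPair) (onlyOneIn (λ x x≢q x≢p → inPair x x≢p x≢q))
  where
  inPair : ∀ x → x ≢ p → x ≢ q → ⊥
  inPair x x≢p x≢q = nothingOutside (x , x≢p , x≢q)

  apart : ∀ {x y r} → x ≢ y → x ≡ r → y ≢ r
  apart x≢y x≡r y≡r = x≢y (trans x≡r (sym y≡r))

  onlyOneIn : ∀ {r s} → (∀ x → x ≢ r → x ≢ s → ⊥) → a ≢ r
  onlyOneIn inRS a≡r =
    inRS b (apart a≢b a≡r) (λ b≡s → inRS c (apart a≢c a≡r) (apart b≢c b≡s))

singleton : {A : Set} → V A → A → V A
singleton u c = mk ⊤ (λ _ → u) (λ _ → c)

∅ : {A : Set} → V A
∅ = mk ⊥ (λ ()) (λ ())

module CoboundedAlgebraProperties (𝔸 : CoboundedAlgebra) where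
  open CoboundedAlgebra 𝔸
  open IsDistributiveLattice isDistributiveLattice using (isLattice; ∧-comm)

  lattice : Lattice _ _
  lattice = record { isLattice = isLattice }

  open LatticeProperties lattice public using (∧-idem)

  ∧-identityˡ : ∀ a → 𝟏 ∧ a ≡ a
  ∧-identityˡ a = trans (∧-comm 𝟏 a) (𝟏-top a)

  ∧-zeroʳ : ∀ a → a ∧ 𝟎 ≡ 𝟎
  ∧-zeroʳ a = trans (∧-comm a 𝟎) (𝟎-bottom a)

  ∧-≡𝟎ˡ : ∀ {a b} → a ≡ 𝟎 → a ∧ b ≡ 𝟎
  ∧-≡𝟎ˡ {b = b} refl = 𝟎-bottom b

  ∧-≡𝟎ʳ : ∀ {a b} → b ≡ 𝟎 → a ∧ b ≡ 𝟎
  ∧-≡𝟎ʳ {a} refl = ∧-zeroʳ a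

  ≤-antisym : ∀ {a b} → a ≤ b → b ≤ a → a ≡ b
  ≤-antisym {a} {b} a≤b b≤a = trans (sym a≤b) (trans (∧-comm a b) b≤a)

  ⋀-≡𝟎 : ∀ {I : Set₁} (f : I → Carrier) i → f i ≡ 𝟎 → ⋀ f ≡ 𝟎
  ⋀-≡𝟎 f i fi≡𝟎 = begin
    ⋀ f        ≡⟨ sym (⋀-lower f i) ⟩
    ⋀ f ∧ f i  ≡⟨ ∧-≡𝟎ʳ fi≡𝟎 ⟩
    𝟎          ∎
    where open ≡-Reasoning

  ⋀-≡𝟏 : ∀ {I : Set₁} {f : I → Carrier} → (∀ i → f i ≡ 𝟏) → ⋀ f ≡ 𝟏
  ⋀-≡𝟏 {f = f} all𝟏 =
    ≤-antisym (𝟏-top (⋀ f))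
      (⋀-greatest f 𝟏 (λ i → trans (∧-identityˡ (f i)) (all𝟏 i)))

  ⋁-max : ∀ {I : Set₁} (f : I → Carrier) i → (∀ j → f j ≤ f i) → ⋁ f ≡ f i
  ⋁-max f i max = ≤-antisym (⋁-least f (f i) max) (⋁-upper f i)

  TwoValued : Carrier → Set
  TwoValued a = a ≢ 𝟎 → a ≡ 𝟏

  ⇒-twoValued : ∀ {a b} → TwoValued (a ⇒ b)
  ⇒-twoValued {a} {b} a⇒b≢𝟎 =
    ⇒-one a b (λ { (a≢𝟎 , b≡𝟎) → a⇒b≢𝟎 (⇒-zero a b a≢𝟎 b≡𝟎) })

  ∧-twoValued : ∀ {a b} → TwoValued a → TwoValued b → TwoValued (a ∧ b)
  ∧-twoValued {a} {b} twoA twoB a∧b≢𝟎 = begin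
    a ∧ b  ≡⟨ cong₂ _∧_ (twoA (a∧b≢𝟎 ∘ ∧-≡𝟎ˡ)) (twoB (a∧b≢𝟎 ∘ ∧-≡𝟎ʳ)) ⟩
    𝟏 ∧ 𝟏  ≡⟨ ∧-idem 𝟏 ⟩
    𝟏      ∎
    where open ≡-Reasoning

  ⋀-twoValued : ∀ {I : Set₁} {f : I → Carrier} → (∀ i → TwoValued (f i)) →
    TwoValued (⋀ f)
  ⋀-twoValued {f = f} two ⋀f≢𝟎 = ⋀-≡𝟏 (λ i → two i (λ fi≡𝟎 → ⋀f≢𝟎 (⋀-≡𝟎 f i fi≡𝟎)))

  ⇒-≡𝟏 : ∀ {a b} → (a ≢ 𝟎 → b ≢ 𝟎) → a ⇒ b ≡ 𝟏
  ⇒-≡𝟏 {a} {b} a≢𝟎⇒b≢𝟎 = ⇒-one a b (λ { (a≢𝟎 , b≡𝟎) → a≢𝟎⇒b≢𝟎 a≢𝟎 b≡𝟎 })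

  ∧-≢𝟎 : ∀ {a b} → a ≢ 𝟎 → TwoValued b → b ≢ 𝟎 → a ∧ b ≢ 𝟎
  ∧-≢𝟎 {a} a≢𝟎 twoB b≢𝟎 a∧b≡𝟎 =
    a≢𝟎 (trans (sym (trans (cong (a ∧_) (twoB b≢𝟎)) (𝟏-top a))) a∧b≡𝟎)

module DesignatedCoboundedAlgebraProperties (𝔻 : DesignatedCoboundedAlgebra) where
  open DesignatedCoboundedAlgebra 𝔻
  open CoboundedAlgebra 𝔸
  open CoboundedAlgebraProperties 𝔸
  open Semantics 𝔻

  𝟏≢𝟎 : 𝟏 ≢ 𝟎
  𝟏≢𝟎 𝟏≡𝟎 = D-𝟎 (subst D 𝟏≡𝟎 D-𝟏)

  *-≢𝟎 : ∀ {c} → c ≢ 𝟎 → c ≢ 𝟏 → c * ≢ 𝟎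
  *-≢𝟎 {c} c≢𝟎 c≢𝟏 c*≡𝟎 = 𝟏≢𝟎 (trans (sym (*-¬D c c∉D)) c*≡𝟎)
    where
    c∉D : ¬ D c
    c∉D c∈D = c≢𝟎 (trans (sym (*-D c c∈D c≢𝟏)) c*≡𝟎)

  ⇔-≡𝟏 : ∀ {a b} → (a ≢ 𝟎 → b ≢ 𝟎) → (b ≢ 𝟎 → a ≢ 𝟎) → a ⇔ b ≡ 𝟏
  ⇔-≡𝟏 a≢𝟎⇒b≢𝟎 b≢𝟎⇒a≢𝟎 =
    trans (cong₂ _∧_ (⇒-≡𝟏 a≢𝟎⇒b≢𝟎) (⇒-≡𝟏 b≢𝟎⇒a≢𝟎)) (∧-idem 𝟏)

  ≐-twoValued : ∀ u v → TwoValued ⟦ u ≐ v ⟧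
  ≐-twoValued (mk _ _ _) (mk _ _ _) =
    ∧-twoValued (⋀-twoValued (λ _ → ∧-twoValued ⇒-twoValued ⇒-twoValued))
                (⋀-twoValued (λ _ → ∧-twoValued ⇒-twoValued ⇒-twoValued))

  ∅≐∅ : ⟦ ∅ ≐ ∅ ⟧ ≡ 𝟏
  ∅≐∅ = trans (cong₂ _∧_ (⋀-≡𝟏 (λ ())) (⋀-≡𝟏 (λ ()))) (∧-idem 𝟏)

  ∈-singleton : ∀ z u c → ⟦ z ∈ singleton u c ⟧ ≡ c ∧ ⟦ u ≐ z ⟧
  ∈-singleton z u c = ⋁-max _ (lift tt) (λ _ → ∧-idem (c ∧ ⟦ u ≐ z ⟧))

  ∅∈singleton∅ : ∀ c → ⟦ ∅ ∈ singleton ∅ c ⟧ ≡ c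
  ∅∈singleton∅ c = begin
    ⟦ ∅ ∈ singleton ∅ c ⟧  ≡⟨ ∈-singleton ∅ ∅ c ⟩
    c ∧ ⟦ ∅ ≐ ∅ ⟧          ≡⟨ cong (c ∧_) ∅≐∅ ⟩
    c ∧ 𝟏                  ≡⟨ 𝟏-top c ⟩
    c                      ∎
    where open ≡-Reasoning

  singleton-coextensional : ∀ u {c d} → c ≢ 𝟎 → d ≢ 𝟎 →
    ∀ z → ⟦ z ∈ singleton u c ⟧ ⇔ ⟦ z ∈ singleton u d ⟧ ≡ 𝟏
  singleton-coextensional u {c} {d} c≢𝟎 d≢𝟎 z =
    ⇔-≡𝟏 (nonzeroTogether c d d≢𝟎) (nonzeroTogether d c c≢𝟎)
    where
    nonzeroTogether : ∀ a b → b ≢ 𝟎 →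
      ⟦ z ∈ singleton u a ⟧ ≢ 𝟎 → ⟦ z ∈ singleton u b ⟧ ≢ 𝟎
    nonzeroTogether a b b≢𝟎 z∈a≢𝟎 rewrite ∈-singleton z u a | ∈-singleton z u b =
      ∧-≢𝟎 b≢𝟎 (≐-twoValued u z) (z∈a≢𝟎 ∘ ∧-≡𝟎ʳ)

  singleton∅-≐-≡𝟎 : ∀ {c d} → c * ≢ 𝟎 → d * ≡ 𝟎 →
    ⟦ singleton ∅ c ≐ singleton ∅ d ⟧ ≡ 𝟎
  singleton∅-≐-≡𝟎 {c} c*≢𝟎 d*≡𝟎 =
    ∧-≡𝟎ʳ (⋀-≡𝟎 _ (lift tt) (∧-≡𝟎ʳ (⇒-zero _ _ ∅∈singleton∅*≢𝟎 d*≡𝟎)))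
    where
    ∅∈singleton∅*≢𝟎 : ⟦ ∅ ∈ singleton ∅ c ⟧ * ≢ 𝟎
    ∅∈singleton∅*≢𝟎 = subst (λ a → a * ≢ 𝟎) (sym (∅∈singleton∅ c)) c*≢𝟎

  ⟦Extensionality⟧≡𝟎 : ∀ {c} → c ≢ 𝟎 → c ≢ 𝟏 → ⟦Extensionality⟧ ≡ 𝟎
  ⟦Extensionality⟧≡𝟎 {c} c≢𝟎 c≢𝟏 =
    ⋀-≡𝟎 _ X (⋀-≡𝟎 _ Y (⇒-zero _ _ sameMembers≢𝟎 X≐Y≡𝟎))
    where
    X Y : V Carrier
    X = singleton ∅ c
    Y = singleton ∅ 𝟏

    sameMembers≢𝟎 : ⋀ (λ z → ⟦ z ∈ X ⟧ ⇔ ⟦ z ∈ Y ⟧) ≢ 𝟎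
    sameMembers≢𝟎 = 𝟏≢𝟎 ∘ trans (sym (⋀-≡𝟏 (singleton-coextensional ∅ c≢𝟎 𝟏≢𝟎)))

    X≐Y≡𝟎 : ⟦ X ≐ Y ⟧ ≡ 𝟎
    X≐Y≡𝟎 = singleton∅-≐-≡𝟎 (*-≢𝟎 c≢𝟎 c≢𝟏) (*-𝟏 𝟏 refl)

mainTheorem16 : (𝔻 : DesignatedCoboundedAlgebra)
    → MoreThanTwoElements (CoboundedAlgebra.Carrier (DesignatedCoboundedAlgebra.𝔸 𝔻))
    → ¬ Semantics.Valid 𝔻 (Semantics.⟦Extensionality⟧ 𝔻)
mainTheorem16 𝔻 moreThanTwo valid =
  moreThanTwoElements⇒¬¬∉pair moreThanTwo 𝟎 𝟏
    (λ { (c , c≢𝟎 , c≢𝟏) → D-𝟎 (subst D (⟦Extensionality⟧≡𝟎 c≢𝟎 c≢𝟏) valid) })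
  where
  open DesignatedCoboundedAlgebra 𝔻
  open CoboundedAlgebra 𝔸
  open DesignatedCoboundedAlgebraProperties 𝔻
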